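{- Let $n,s\in\mathbb{N}$ and $b,\omega,\sigma>0$ with $\omega n>b$ and $\omega+\sigma\le b$, and let $\eta>0$. Suppose $G$ is a graph on $n$ vertices with degree sequence $d_{G,1}\le\dots\le d_{G,n}$ such that \[d_{G,i}\ge\frac{b-\omega-\sigma}{b}n+\frac{\sigma}{\omega}i+\eta n\quad\text{for all }1\le i\le\frac{\omega n}{b}.\] Then $\bar G:=G(s)$ has degree sequence $d_{\bar G,1}\le\dots\le d_{\bar G,ns}$ such that \[d_{\bar G,i}\ge\frac{b-\omega-\sigma}{b}ns+\frac{\sigma}{\omega}i+\left(\eta n-\frac{\sigma}{\omega}\right)s\quad\text{for all }1\le i\le\frac{\omega ns}{b}.\]
   Context: For a graph $G$ and $s\in\mathbb{N}$, the blow-up $G(s)$ is obtained by replacing each vertex $x$ by a set $V_x$ of $s$ independent vertices and each edge $xy$ by all edges between $V_x$ and $V_y$. Degree sequences list vertex degrees in non-decreasing order.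
   Formalization: The parameters b, ω, σ and η range over the positive rationals. -}

module Defs where

open import Data.Bool using (Bool; true; false; if_then_else_)
open import Data.Nat using (ℕ; zero; suc; _∸_) renaming (_*_ to _*ℕ_)
open import Data.Nat.Properties using (≤-decTotalOrder)
open import Data.Fin using (Fin; remQuot)
open import Data.List using (List; []; _∷_; map; allFin)
open import Data.Nat.ListAction using (sum)
open import Data.Integer using (+_)
open import Data.Product using (proj₁)
open import Relation.Binary.PropositionalEquality using (_≡_)
open import Data.Rational using (ℚ; Positive; _÷_; _/_)
open import Data.Rational.Properties using (pos⇒nonZero)
import Data.List.Sort

record Graph (n : ℕ) : Set where
  field
    adj   : Fin n → Fin n → Bool
    sym   : ∀ x y → adj x y ≡ adj y x
    irrefl : ∀ x → adj x x ≡ false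
open Graph public

deg : ∀ {n} → Graph n → Fin n → ℕ
deg {n} G x = sum (map (λ y → if adj G x y then 1 else 0) (allFin n))

open Data.List.Sort ≤-decTotalOrder using (sort)

degSeq : ∀ {n} → Graph n → List ℕ
degSeq {n} G = sort (map (deg G) (allFin n))

-- 0-indexed list lookup (default 0 out of range; only used in range)
nth : List ℕ → ℕ → ℕ
nth []       _       = 0
nth (x ∷ xs) zero    = x
nth (x ∷ xs) (suc k) = nth xs k

-- d_{G,i} : the i-th smallest degree, 1-indexed (1 ≤ i ≤ n)
d : ∀ {n} → Graph n → ℕ → ℕ
d G i = nth (degSeq G) (i ∸ 1)

-- blow-up G(s): vertex set Fin (n * s) ≅ Fin n × Fin s via remQuot;
-- vertex (x , j) lies in the class V_x.
blowUp : ∀ {n} → Graph n → (s : ℕ) → Graph (n *ℕ s)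
blowUp {n} G s = record
  { adj    = λ u v → adj G (cls u) (cls v)
  ; sym    = λ u v → sym G (cls u) (cls v)
  ; irrefl = λ u → irrefl G (cls u)
  }
  where
  cls : Fin (n *ℕ s) → Fin n
  cls u = proj₁ (remQuot {n} s u)

_÷⁺_ : (p q : ℚ) → .{{Positive q}} → ℚ
p ÷⁺ q = (p ÷ q) {{pos⇒nonZero q}}
infixl 7 _÷⁺_

fromℕ : ℕ → ℚ
fromℕ m = (+ m) / 1

-- Write Ḡ = G(s) and, for a class index j, let d_{G,j} be the j-th smallest
-- degree of G.  Every vertex of the class V_x has degree s · deg_G(x), so the
-- number of vertices of Ḡ with degree below s·t is exactly s times the number
-- of vertices of G with degree below t.  Since in a sorted list at most m
-- entries lie strictly below the entry at position m, and conversely any t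
-- with at most m entries below it is bounded by that entry, this gives the
-- rank comparison  d_{Ḡ,i} ≥ s · d_{G,j}  whenever s(j-1) < i ≤ ns.
--
-- For a position i of Ḡ we choose the class index j = max(1, ⌊(i-1)/s⌋):
-- then s(j-1) < i ≤ (j+1)s, and either j = 1 or js ≤ i.  The latter makes j
-- an admissible index for the hypothesis on G (j ≤ ωn/b), and multiplying
-- that hypothesis by s loses at most (σ/ω)·s because i ≤ (j+1)s.
module Submission where

open import Defs
open import Data.Bool using (if_then_else_)
open import Data.Nat as ℕ using (ℕ; zero; suc; z≤n; s≤s; _<?_)
  renaming (_≤_ to _≤ℕ_; _<_ to _<ℕ_; _*_ to _*ℕ_)
import Data.Nat.Properties as ℕP
open import Data.Nat.DivMod using (_/_; _%_; m≡m%n+[m/n]*n; m%n<n)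
open import Data.Nat.ListAction using (sum)
open import Data.Nat.ListAction.Properties using (sum-↭)
open import Data.Integer as ℤ using (+_)
import Data.Integer.Properties as ℤP
open import Data.Integer.Tactic.RingSolver using (solve-∀)
open import Data.Fin as Fin using (Fin; remQuot; _↑ˡ_; _↑ʳ_)
open import Data.Fin.Properties using (splitAt-↑ˡ; splitAt-↑ʳ)
open import Data.List using (List; []; _∷_; map; allFin; tabulate; length)
open import Data.List.Properties using (map-tabulate; map-∘; length-map; length-tabulate)
open import Data.List.Relation.Binary.Permutation.Propositional using (_↭_)
open import Data.List.Relation.Binary.Permutation.Propositional.Properties using (map⁺; ↭-length)
open import Data.List.Relation.Unary.All as All using (All; []; _∷_)
open import Data.List.Relation.Unary.AllPairs using (AllPairs; []; _∷_)
open import Data.List.Relation.Unary.Linked.Properties using (Linked⇒AllPairs)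
import Data.List.Sort
open import Data.Rational
  using (ℚ; Positive; NonNegative; _+_; _-_; _*_; _≤_; _<_; 1/_; 1ℚ; toℚᵘ)
open import Data.Rational.Properties
  using ( toℚᵘ-injective; toℚᵘ-fromℚᵘ; toℚᵘ-homo-+; toℚᵘ-homo-*; toℚᵘ-mono-≤; toℚᵘ-cancel-≤
        ; normalize-nonNeg; normalize-pos; pos⇒nonZero; pos⇒nonNeg; pos*pos⇒pos; 1/pos⇒pos
        ; nonNegative⁻¹; *-inverseʳ; *-identityʳ; *-monoʳ-≤-nonNeg; *-monoˡ-≤-nonNeg
        ; *-cancelʳ-≤-pos; +-identityʳ; +-monoʳ-≤; +-monoˡ-≤; <⇒≤; ≤-trans; ≤-reflexive)
  renaming (module ≤-Reasoning to ℚ-≤-Reasoning)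
open import Data.Rational.Solver using (module +-*-Solver)
open import Data.Rational.Unnormalised as ℚᵘ using (ℚᵘ; mkℚᵘ; _≃_; *≡*; *≤*)
import Data.Rational.Unnormalised.Properties as ℚᵘP
open import Data.Product using (proj₁)
open import Data.Sum using (_⊎_; inj₁; inj₂)
open import Function using (_∘_; id)
open import Relation.Nullary using (yes; no; contradiction)
open import Relation.Binary.PropositionalEquality
  using (_≡_; refl; cong; cong₂; subst; subst₂; module ≡-Reasoning)
  renaming (sym to ≡-sym; trans to ≡-trans)

open Data.List.Sort ℕP.≤-decTotalOrder using (sort-↭; sort-↗)

Σ : ∀ {n} → (Fin n → ℕ) → ℕ
Σ {zero}  f = 0
Σ {suc n} f = f Fin.zero ℕ.+ Σ (f ∘ Fin.suc)

sum-allFin : ∀ {n} (f : Fin n → ℕ) → sum (map f (allFin n)) ≡ Σ f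
sum-allFin f = ≡-trans (cong sum (map-tabulate id f)) (sum-tabulate f)
  where
  sum-tabulate : ∀ {n} (f : Fin n → ℕ) → sum (tabulate f) ≡ Σ f
  sum-tabulate {zero}  f = refl
  sum-tabulate {suc n} f = cong (f Fin.zero ℕ.+_) (sum-tabulate (f ∘ Fin.suc))

Σ-cong : ∀ {n} {f g : Fin n → ℕ} → (∀ x → f x ≡ g x) → Σ f ≡ Σ g
Σ-cong {zero}  f≗g = refl
Σ-cong {suc n} f≗g = cong₂ ℕ._+_ (f≗g Fin.zero) (Σ-cong (f≗g ∘ Fin.suc))

Σ-const : ∀ n c → Σ {n} (λ _ → c) ≡ n *ℕ c
Σ-const zero    c = refl
Σ-const (suc n) c = cong (c ℕ.+_) (Σ-const n c)

Σ-++ : ∀ m k (f : Fin (m ℕ.+ k) → ℕ) → Σ f ≡ Σ (f ∘ (_↑ˡ k)) ℕ.+ Σ (f ∘ (m ↑ʳ_))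
Σ-++ zero    k f = refl
Σ-++ (suc m) k f =
  ≡-trans (cong (f Fin.zero ℕ.+_) (Σ-++ m k (f ∘ Fin.suc))) (≡-sym (ℕP.+-assoc (f Fin.zero) _ _))

classOf : ∀ n s → Fin (n *ℕ s) → Fin n
classOf n s u = proj₁ (remQuot {n} s u)

Σ-classOf : ∀ n s (h : Fin n → ℕ) → Σ (h ∘ classOf n s) ≡ s *ℕ Σ h
Σ-classOf zero    s h = ≡-sym (ℕP.*-zeroʳ s)
Σ-classOf (suc n) s h = begin
  Σ (h ∘ classOf (suc n) s)
    ≡⟨ Σ-++ s (n *ℕ s) _ ⟩
  Σ (λ j → h (classOf (suc n) s (j ↑ˡ n *ℕ s))) ℕ.+ Σ (λ u → h (classOf (suc n) s (s ↑ʳ u)))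
    ≡⟨ cong₂ ℕ._+_ (Σ-cong first-class) (Σ-cong other-classes) ⟩
  Σ {s} (λ _ → h Fin.zero) ℕ.+ Σ (h ∘ Fin.suc ∘ classOf n s)
    ≡⟨ cong₂ ℕ._+_ (Σ-const s _) (Σ-classOf n s (h ∘ Fin.suc)) ⟩
  s *ℕ h Fin.zero ℕ.+ s *ℕ Σ (h ∘ Fin.suc)
    ≡⟨ ≡-sym (ℕP.*-distribˡ-+ s _ _) ⟩
  s *ℕ Σ h ∎
  where
  open ≡-Reasoning
  first-class : ∀ j → h (classOf (suc n) s (j ↑ˡ n *ℕ s)) ≡ h Fin.zero
  first-class j rewrite splitAt-↑ˡ s j (n *ℕ s) = refl
  other-classes : ∀ u → h (classOf (suc n) s (s ↑ʳ u)) ≡ h (Fin.suc (classOf n s u))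
  other-classes u rewrite splitAt-↑ʳ s (n *ℕ s) u = refl

deg-blowUp : ∀ {n} (G : Graph n) s u → deg (blowUp G s) u ≡ s *ℕ deg G (classOf n s u)
deg-blowUp {n} G s u = begin
  deg (blowUp G s) u            ≡⟨ sum-allFin (edge ∘ classOf n s) ⟩
  Σ (edge ∘ classOf n s)        ≡⟨ Σ-classOf n s edge ⟩
  s *ℕ Σ edge                   ≡⟨ cong (s *ℕ_) (≡-sym (sum-allFin edge)) ⟩
  s *ℕ deg G (classOf n s u)    ∎
  where
  open ≡-Reasoning
  edge : Fin n → ℕ
  edge y = if adj G (classOf n s u) y then 1 else 0

isBelow : ℕ → ℕ → ℕ
isBelow t x with x <? t
... | yes _ = 1
... | no  _ = 0

countBelow : ℕ → List ℕ → ℕ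
countBelow t xs = sum (map (isBelow t) xs)

countBelow-↭ : ∀ t {xs ys} → xs ↭ ys → countBelow t xs ≡ countBelow t ys
countBelow-↭ t xs↭ys = sum-↭ (map⁺ (isBelow t) xs↭ys)

isBelow≤1 : ∀ t x → isBelow t x ≤ℕ 1
isBelow≤1 t x with x <? t
... | yes _ = ℕP.≤-refl
... | no  _ = z≤n

isBelow-scale : ∀ k t x → isBelow (suc k *ℕ t) (suc k *ℕ x) ≡ isBelow t x
isBelow-scale k t x with suc k *ℕ x <? suc k *ℕ t | x <? t
... | yes _   | yes _   = refl
... | no  _   | no  _   = refl
... | yes kx<kt | no x≮t = contradiction (ℕP.*-cancelˡ-< (suc k) x t kx<kt) x≮t
... | no kx≮kt  | yes x<t = contradiction (ℕP.*-monoʳ-< (suc k) x<t) kx≮kt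

countBelow-≥ : ∀ t {xs} → All (t ≤ℕ_) xs → countBelow t xs ≡ 0
countBelow-≥ t [] = refl
countBelow-≥ t {x ∷ xs} (t≤x ∷ t≤xs) with x <? t
... | yes x<t = contradiction t≤x (ℕP.<⇒≱ x<t)
... | no  _   = countBelow-≥ t t≤xs

countBelow-nth : ∀ {xs} m → AllPairs ℕ._≤_ xs → countBelow (nth xs m) xs ≤ℕ m
countBelow-nth {[]}     m       _ = z≤n
countBelow-nth {x ∷ xs} zero    (x≤xs ∷ _) with x <? x
... | yes x<x = contradiction x<x (ℕP.<-irrefl refl)
... | no  _   = ℕP.≤-reflexive (countBelow-≥ x x≤xs)
countBelow-nth {x ∷ xs} (suc m) (_ ∷ sorted) =
  ℕP.+-mono-≤ (isBelow≤1 (nth xs m) x) (countBelow-nth m sorted)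

nth-≥ : ∀ {xs} m t → AllPairs ℕ._≤_ xs → m <ℕ length xs → countBelow t xs ≤ℕ m → t ≤ℕ nth xs m
nth-≥ {x ∷ xs} m t (x≤xs ∷ sorted) m<len below≤m with x <? t | m
... | yes _   | zero   = contradiction below≤m λ ()
... | yes _   | suc m′ = nth-≥ m′ t sorted (ℕP.≤-pred m<len) (ℕP.≤-pred below≤m)
... | no  x≮t | zero   = ℕP.≮⇒≥ x≮t
... | no  x≮t | suc m′ = nth-≥ m′ t sorted (ℕP.≤-pred m<len) (subst (_≤ℕ m′) (≡-sym none-below) z≤n)
  where
  none-below : countBelow t xs ≡ 0
  none-below = countBelow-≥ t (All.map (ℕP.≤-trans (ℕP.≮⇒≥ x≮t)) x≤xs)

degrees : ∀ {n} → Graph n → List ℕ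
degrees {n} G = map (deg G) (allFin n)

degSeq-sorted : ∀ {n} (G : Graph n) → AllPairs ℕ._≤_ (degSeq G)
degSeq-sorted G = Linked⇒AllPairs ℕP.≤-trans (sort-↗ (degrees G))

length-degSeq : ∀ {n} (G : Graph n) → length (degSeq G) ≡ n
length-degSeq {n} G = ≡-trans (↭-length (sort-↭ (degrees G)))
  (≡-trans (length-map (deg G) (allFin n)) (length-tabulate id))

countBelow-blowUp : ∀ {n} (G : Graph n) k t →
  countBelow (suc k *ℕ t) (degrees (blowUp G (suc k))) ≡ suc k *ℕ countBelow t (degrees G)
countBelow-blowUp {n} G k t = begin
  countBelow (s *ℕ t) (degrees (blowUp G s))
    ≡⟨ countBelow-allFin (s *ℕ t) (deg (blowUp G s)) ⟩
  Σ (λ u → isBelow (s *ℕ t) (deg (blowUp G s) u))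
    ≡⟨ Σ-cong (λ u → ≡-trans (cong (isBelow (s *ℕ t)) (deg-blowUp G s u)) (isBelow-scale k t _)) ⟩
  Σ (λ u → isBelow t (deg G (classOf n s u)))
    ≡⟨ Σ-classOf n s (isBelow t ∘ deg G) ⟩
  s *ℕ Σ (isBelow t ∘ deg G)
    ≡⟨ cong (s *ℕ_) (≡-sym (countBelow-allFin t (deg G))) ⟩
  s *ℕ countBelow t (degrees G) ∎
  where
  open ≡-Reasoning
  s = suc k
  countBelow-allFin : ∀ {m} t (f : Fin m → ℕ) → countBelow t (map f (allFin m)) ≡ Σ (isBelow t ∘ f)
  countBelow-allFin {m} t f = ≡-trans (cong sum (≡-sym (map-∘ (allFin m)))) (sum-allFin (isBelow t ∘ f))

-- Rank comparison (0-indexed): if s·p ≤ m < ns then s·d_{G,p+1} ≤ d_{G(s),m+1}.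
degSeq-blowUp : ∀ {n} (G : Graph n) k p m → suc k *ℕ p ≤ℕ m → m <ℕ n *ℕ suc k →
  suc k *ℕ nth (degSeq G) p ≤ℕ nth (degSeq (blowUp G (suc k))) m
degSeq-blowUp {n} G k p m sp≤m m<ns =
  nth-≥ m (s *ℕ D) (degSeq-sorted Ḡ) (subst (m <ℕ_) (≡-sym (length-degSeq Ḡ)) m<ns) below≤m
  where
  s = suc k
  Ḡ = blowUp G s
  D = nth (degSeq G) p
  below≤m : countBelow (s *ℕ D) (degSeq Ḡ) ≤ℕ m
  below≤m = begin
    countBelow (s *ℕ D) (degSeq Ḡ)    ≡⟨ countBelow-↭ (s *ℕ D) (sort-↭ (degrees Ḡ)) ⟩
    countBelow (s *ℕ D) (degrees Ḡ)   ≡⟨ countBelow-blowUp G k D ⟩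
    s *ℕ countBelow D (degrees G)     ≡⟨ cong (s *ℕ_) (≡-sym (countBelow-↭ D (sort-↭ (degrees G)))) ⟩
    s *ℕ countBelow D (degSeq G)      ≤⟨ ℕP.*-monoʳ-≤ s (countBelow-nth p (degSeq-sorted G)) ⟩
    s *ℕ p                            ≤⟨ sp≤m ⟩
    m                                 ∎
    where open ℕP.≤-Reasoning

-- The class index for position m+1 of G(s) (0-indexed: j = p + 1 in the
-- paper's notation): s(j-1) < m+1 ≤ (j+1)s, and either j = 1 or js ≤ m+1.
record ClassIndex (s m : ℕ) : Set where
  field
    p          : ℕ
    blockStart  : s *ℕ p ≤ℕ m
    blockEnd    : suc m ≤ℕ suc (suc p) *ℕ s
    firstOrFull : p ≡ 0 ⊎ suc p *ℕ s ≤ℕ suc m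

-- Choose j = max(1, ⌊m/s⌋) from the division m = r + q·s with r < s.
classIndex : ∀ k m → ClassIndex (suc k) m
classIndex k m = fromDivision (m % s) (m / s) (m≡m%n+[m/n]*n m s) (m%n<n m s)
  where
  s = suc k
  open ℕP.≤-Reasoning
  fromDivision : ∀ r q → m ≡ r ℕ.+ q *ℕ s → r <ℕ s → ClassIndex s m
  fromDivision r zero m≡r r<s = record
    { p = 0
    ; blockStart = subst (_≤ℕ m) (≡-sym (ℕP.*-zeroʳ s)) z≤n
    ; blockEnd = begin
        suc m             ≡⟨ cong suc (≡-trans m≡r (ℕP.+-identityʳ r)) ⟩
        suc r             ≤⟨ r<s ⟩
        s                 ≤⟨ ℕP.m≤m+n s _ ⟩
        2 *ℕ s            ∎
    ; firstOrFull = inj₁ refl }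
  fromDivision r (suc q) m≡r+qs r<s = record
    { p = q
    ; blockStart = begin
        s *ℕ q            ≡⟨ ℕP.*-comm s q ⟩
        q *ℕ s            ≤⟨ ℕP.m≤n+m (q *ℕ s) s ⟩
        suc q *ℕ s        ≤⟨ ℕP.m≤n+m _ r ⟩
        r ℕ.+ suc q *ℕ s  ≡⟨ ≡-sym m≡r+qs ⟩
        m                 ∎
    ; blockEnd = begin
        suc m                  ≡⟨ cong suc m≡r+qs ⟩
        suc r ℕ.+ suc q *ℕ s   ≤⟨ ℕP.+-monoˡ-≤ (suc q *ℕ s) r<s ⟩
        suc (suc q) *ℕ s       ∎
    ; firstOrFull = inj₂ (begin
        suc q *ℕ s        ≤⟨ ℕP.m≤n+m _ r ⟩
        r ℕ.+ suc q *ℕ s  ≡⟨ ≡-sym m≡r+qs ⟩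
        m                 ≤⟨ ℕP.n≤1+n m ⟩
        suc m             ∎) }

-- fromℕ is computed through the unnormalised rationals, where it is m / 1.
ι : ℕ → ℚᵘ
ι m = mkℚᵘ (+ m) 0

fromℕ≃ι : ∀ m → toℚᵘ (fromℕ m) ≃ ι m
fromℕ≃ι m = toℚᵘ-fromℚᵘ (ι m)

fromℕ-+ : ∀ m n → fromℕ (m ℕ.+ n) ≡ fromℕ m + fromℕ n
fromℕ-+ m n = toℚᵘ-injective (begin
  toℚᵘ (fromℕ (m ℕ.+ n))             ≈⟨ fromℕ≃ι (m ℕ.+ n) ⟩
  ι (m ℕ.+ n)                        ≈⟨ *≡* (≡-trans (cong (ℤ._* + 1) (ℤP.pos-+ m n)) (ι-+ (+ m) (+ n))) ⟩
  ι m ℚᵘ.+ ι n                       ≈⟨ ℚᵘP.+-cong (ℚᵘP.≃-sym (fromℕ≃ι m)) (ℚᵘP.≃-sym (fromℕ≃ι n)) ⟩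
  toℚᵘ (fromℕ m) ℚᵘ.+ toℚᵘ (fromℕ n) ≈⟨ ℚᵘP.≃-sym (toℚᵘ-homo-+ (fromℕ m) (fromℕ n)) ⟩
  toℚᵘ (fromℕ m + fromℕ n)           ∎)
  where
  open ℚᵘP.≃-Reasoning
  ι-+ : ∀ x y → (x ℤ.+ y) ℤ.* + 1 ≡ (x ℤ.* + 1 ℤ.+ y ℤ.* + 1) ℤ.* + 1
  ι-+ = solve-∀

fromℕ-* : ∀ m n → fromℕ (m *ℕ n) ≡ fromℕ m * fromℕ n
fromℕ-* m n = toℚᵘ-injective (begin
  toℚᵘ (fromℕ (m *ℕ n))              ≈⟨ fromℕ≃ι (m *ℕ n) ⟩
  ι (m *ℕ n)                         ≈⟨ ℚᵘP.≃-reflexive (cong (λ z → mkℚᵘ z 0) (ℤP.pos-* m n)) ⟩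
  ι m ℚᵘ.* ι n                       ≈⟨ ℚᵘP.*-cong (ℚᵘP.≃-sym (fromℕ≃ι m)) (ℚᵘP.≃-sym (fromℕ≃ι n)) ⟩
  toℚᵘ (fromℕ m) ℚᵘ.* toℚᵘ (fromℕ n) ≈⟨ ℚᵘP.≃-sym (toℚᵘ-homo-* (fromℕ m) (fromℕ n)) ⟩
  toℚᵘ (fromℕ m * fromℕ n)           ∎)
  where open ℚᵘP.≃-Reasoning

fromℕ-suc : ∀ m → fromℕ (suc m) ≡ 1ℚ + fromℕ m
fromℕ-suc = fromℕ-+ 1

fromℕ-mono-≤ : ∀ {m n} → m ≤ℕ n → fromℕ m ≤ fromℕ n
fromℕ-mono-≤ {m} {n} m≤n = toℚᵘ-cancel-≤
  (ℚᵘP.≤-respʳ-≃ (ℚᵘP.≃-sym (fromℕ≃ι n)) (ℚᵘP.≤-respˡ-≃ (ℚᵘP.≃-sym (fromℕ≃ι m))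
    (*≤* (ℤP.*-monoʳ-≤-nonNeg (+ 1) (ℤ.+≤+ m≤n)))))

fromℕ-cancel-≤ : ∀ {m n} → fromℕ m ≤ fromℕ n → m ≤ℕ n
fromℕ-cancel-≤ {m} {n} fm≤fn
  with ℚᵘP.≤-respʳ-≃ (fromℕ≃ι n) (ℚᵘP.≤-respˡ-≃ (fromℕ≃ι m) (toℚᵘ-mono-≤ fm≤fn))
... | *≤* m≤n = ℤP.drop‿+≤+ (subst₂ ℤ._≤_ (ℤP.*-identityʳ (+ m)) (ℤP.*-identityʳ (+ n)) m≤n)

fromℕ-nonNeg : ∀ m → NonNegative (fromℕ m)
fromℕ-nonNeg m = normalize-nonNeg m 1

fromℕ-pos : ∀ k → Positive (fromℕ (suc k))
fromℕ-pos k = normalize-pos (suc k) 1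

÷⁺-nonNeg : ∀ p q .{{_ : Positive p}} .{{_ : Positive q}} → NonNegative (p ÷⁺ q)
÷⁺-nonNeg p q = pos⇒nonNeg (p ÷⁺ q) {{pos*pos⇒pos p _ {{1/pos⇒pos q}}}}

÷⁺-mono-≤ : ∀ {p q} r .{{_ : Positive r}} → p ≤ q → p ÷⁺ r ≤ q ÷⁺ r
÷⁺-mono-≤ r = *-monoʳ-≤-nonNeg r⁻¹ {{pos⇒nonNeg r⁻¹ {{1/pos⇒pos r}}}}
  where r⁻¹ = (1/ r) {{pos⇒nonZero r}}

*-÷⁺-cancelˡ : ∀ p q .{{_ : Positive p}} → p * q ÷⁺ p ≡ q
*-÷⁺-cancelˡ p q = begin
  p * q * p⁻¹    ≡⟨ solve 3 (λ p q p⁻¹ → p :* q :* p⁻¹ := q :* (p :* p⁻¹)) refl p q p⁻¹ ⟩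
  q * (p * p⁻¹)  ≡⟨ cong (q *_) (*-inverseʳ p {{pos⇒nonZero p}}) ⟩
  q * 1ℚ         ≡⟨ *-identityʳ q ⟩
  q              ∎
  where
  open ≡-Reasoning
  open +-*-Solver
  p⁻¹ = (1/ p) {{pos⇒nonZero p}}

position-bound : ∀ {i M} (b ω σ : ℚ) .{{_ : Positive b}} .{{_ : Positive σ}} →
  ω + σ ≤ b → fromℕ i ≤ ω * fromℕ M ÷⁺ b → i ≤ℕ M
position-bound {i} {M} b ω σ ω+σ≤b i≤ωM/b = fromℕ-cancel-≤ (begin
  fromℕ i              ≤⟨ i≤ωM/b ⟩
  ω * fromℕ M ÷⁺ b     ≤⟨ ÷⁺-mono-≤ b (*-monoʳ-≤-nonNeg (fromℕ M) {{fromℕ-nonNeg M}} ω≤b) ⟩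
  b * fromℕ M ÷⁺ b     ≡⟨ *-÷⁺-cancelˡ b (fromℕ M) ⟩
  fromℕ M              ∎)
  where
  open ℚ-≤-Reasoning
  ω≤b : ω ≤ b
  ω≤b = ≤-trans (≤-trans (≤-reflexive (≡-sym (+-identityʳ ω))) (+-monoʳ-≤ ω (nonNegative⁻¹ σ {{pos⇒nonNeg σ}}))) ω+σ≤b

classIndex-admissible : ∀ (b ω : ℚ) .{{_ : Positive b}} n k m p →
  p ≡ 0 ⊎ suc p *ℕ suc k ≤ℕ suc m → b < ω * fromℕ n →
  fromℕ (suc m) ≤ ω * fromℕ (n *ℕ suc k) ÷⁺ b → fromℕ (suc p) ≤ ω * fromℕ n ÷⁺ b
classIndex-admissible b ω n k m p (inj₁ refl) b<ωn _ = begin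
  1ℚ                  ≡⟨ ≡-sym (*-÷⁺-cancelˡ b 1ℚ) ⟩
  b * 1ℚ ÷⁺ b         ≡⟨ cong (_÷⁺ b) (*-identityʳ b) ⟩
  b ÷⁺ b              ≤⟨ ÷⁺-mono-≤ b (<⇒≤ b<ωn) ⟩
  ω * fromℕ n ÷⁺ b    ∎
  where open ℚ-≤-Reasoning
classIndex-admissible b ω n k m p (inj₂ js≤i) _ i≤ωns/b =
  *-cancelʳ-≤-pos S {{fromℕ-pos k}} (begin
    fromℕ (suc p) * S          ≡⟨ ≡-sym (fromℕ-* (suc p) (suc k)) ⟩
    fromℕ (suc p *ℕ suc k)     ≤⟨ fromℕ-mono-≤ js≤i ⟩
    fromℕ (suc m)              ≤⟨ i≤ωns/b ⟩
    ω * fromℕ (n *ℕ suc k) ÷⁺ b ≡⟨ cong (λ x → ω * x ÷⁺ b) (fromℕ-* n (suc k)) ⟩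
    ω * (N * S) ÷⁺ b           ≡⟨ solve 4 (λ ω N S b⁻¹ → ω :* (N :* S) :* b⁻¹ := ω :* N :* b⁻¹ :* S) refl ω N S _ ⟩
    ω * N ÷⁺ b * S             ∎)
  where
  open ℚ-≤-Reasoning
  open +-*-Solver
  N = fromℕ n
  S = fromℕ (suc k)

-- Multiplying the bound for d_{G,j} by s: with i ≤ (j+1)s the term (σ/ω)·i
-- costs at most (σ/ω)·js + (σ/ω)·s.
rescale : ∀ (A c N S J I η : ℚ) .{{_ : NonNegative c}} → I ≤ (1ℚ + J) * S →
  A * (N * S) + c * I + (η * N - c) * S ≤ (A * N + c * J + η * N) * S
rescale A c N S J I η I≤[1+J]S = begin
  A * (N * S) + c * I + (η * N - c) * S
    ≤⟨ +-monoˡ-≤ ((η * N - c) * S) (+-monoʳ-≤ (A * (N * S)) (*-monoˡ-≤-nonNeg c I≤[1+J]S)) ⟩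
  A * (N * S) + c * ((1ℚ + J) * S) + (η * N - c) * S
    ≡⟨ solve 6 (λ A c N S J η → A :* (N :* S) :+ c :* ((con 1ℚ :+ J) :* S) :+ (η :* N :- c) :* S
                             := (A :* N :+ c :* J :+ η :* N) :* S) refl A c N S J η ⟩
  (A * N + c * J + η * N) * S ∎
  where
  open ℚ-≤-Reasoning
  open +-*-Solver

proposition6p3 : (n s : ℕ) (b ω σ η : ℚ)
    → .{{_ : Positive b}} → .{{_ : Positive ω}} → .{{_ : Positive σ}} → .{{_ : Positive η}}
    → b < ω * fromℕ n
    → ω + σ ≤ b
    → (G : Graph n)
    → (∀ (i : ℕ) → 1 ≤ℕ i → fromℕ i ≤ ω * fromℕ n ÷⁺ b
         → (b - ω - σ) ÷⁺ b * fromℕ n + σ ÷⁺ ω * fromℕ i + η * fromℕ n ≤ fromℕ (d G i))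
    → (∀ (i : ℕ) → 1 ≤ℕ i → fromℕ i ≤ ω * fromℕ (n *ℕ s) ÷⁺ b
         → (b - ω - σ) ÷⁺ b * fromℕ (n *ℕ s) + σ ÷⁺ ω * fromℕ i
             + (η * fromℕ n - σ ÷⁺ ω) * fromℕ s
           ≤ fromℕ (d (blowUp G s) i))
proposition6p3 n zero b ω σ η b<ωn ω+σ≤b G H (suc m) (s≤s z≤n) i≤ωns/b =
  contradiction (subst (suc m ≤ℕ_) (ℕP.*-zeroʳ n) (position-bound b ω σ ω+σ≤b i≤ωns/b)) λ ()
proposition6p3 n s@(suc k) b ω σ η b<ωn ω+σ≤b G H (suc m) (s≤s z≤n) i≤ωns/b = begin
  A * fromℕ (n *ℕ s) + c * I + (η * N - c) * S
    ≡⟨ cong (λ x → A * x + c * I + (η * N - c) * S) (fromℕ-* n s) ⟩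
  A * (N * S) + c * I + (η * N - c) * S
    ≤⟨ rescale A c N S J I η {{÷⁺-nonNeg σ ω}} I≤[1+J]S ⟩
  (A * N + c * J + η * N) * S
    ≤⟨ *-monoʳ-≤-nonNeg S {{fromℕ-nonNeg s}} (H (suc p) (s≤s z≤n) j-admissible) ⟩
  fromℕ (d G (suc p)) * S
    ≡⟨ ≡-sym (fromℕ-* (d G (suc p)) s) ⟩
  fromℕ (d G (suc p) *ℕ s)
    ≤⟨ fromℕ-mono-≤ (subst (_≤ℕ d (blowUp G s) (suc m)) (ℕP.*-comm s _) rank-comparison) ⟩
  fromℕ (d (blowUp G s) (suc m)) ∎
  where
  open ℚ-≤-Reasoning
  open ClassIndex (classIndex k m)
  A = (b - ω - σ) ÷⁺ b
  c = σ ÷⁺ ω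
  N = fromℕ n
  S = fromℕ s
  I = fromℕ (suc m)
  J = fromℕ (suc p)
  I≤[1+J]S : I ≤ (1ℚ + J) * S
  I≤[1+J]S = ≤-trans (fromℕ-mono-≤ blockEnd)
    (≤-reflexive (≡-trans (fromℕ-* (suc (suc p)) s) (cong (_* S) (fromℕ-suc (suc p)))))
  j-admissible = classIndex-admissible b ω n k m p firstOrFull b<ωn i≤ωns/b
  rank-comparison = degSeq-blowUp G k p m blockStart (position-bound b ω σ ω+σ≤b i≤ωns/b)
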